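{- If $n\ge p$, then $\mathrm{irr}(\Gamma_n^p) = 2 \sum_{d=1}^p|E(\Gamma_{n-d}^p)|$.
   Context: For an integer $p\geq 1$, a Fibonacci $p$-string of length $n$ is a binary string in which any two 1s are separated by at least $p$ 0s. The Fibonacci $p$-cube $\Gamma_n^p$ is the subgraph of the hypercube $Q_n$ induced by the Fibonacci $p$-strings of length $n$ (with $\Gamma_0^p=K_1$). The irregularity of a graph $G$ is $\mathrm{irr}(G)=\sum_{uv\in E(G)}|\deg_G(u)-\deg_G(v)|$. -}

module Defs where

open import Data.Bool using (Bool; true; false; _∧_; _∨_; not; if_then_else_)
open import Data.Nat using (ℕ; zero; suc; _+_; _∸_; _<ᵇ_; _≡ᵇ_; ∣_-_∣)
open import Data.Fin using (Fin; toℕ)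
open import Data.Vec using (Vec; []; _∷_; lookup)
open import Data.List using (List; []; _∷_; map; _++_; filterᵇ; length; allFin)
open import Data.Bool.ListAction using (and)
open import Data.Nat.ListAction using (sum)
open import Data.Product using (_×_; _,_)

allStrings : (n : ℕ) → List (Vec Bool n)
allStrings zero    = [] ∷ []
allStrings (suc n) = map (false ∷_) (allStrings n) ++ map (true ∷_) (allStrings n)

orderedPairs : {A : Set} → List A → List (A × A)
orderedPairs []       = []
orderedPairs (x ∷ xs) = map (x ,_) xs ++ orderedPairs xs

-- Fibonacci p-string: any two 1s (positions i < j) are separated by at least
-- p 0s, i.e. j - i ≥ p + 1.
isFibString : (p n : ℕ) → Vec Bool n → Bool
isFibString p n v =
  and (map (λ { (i , j) → not (lookup v i ∧ lookup v j) ∨ (p <ᵇ (toℕ j ∸ toℕ i)) })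
      (orderedPairs (allFin n)))

vertices : (p n : ℕ) → List (Vec Bool n)
vertices p n = filterᵇ (isFibString p n) (allStrings n)

hamming : {n : ℕ} → Vec Bool n → Vec Bool n → ℕ
hamming []       []       = 0
hamming (a ∷ u) (b ∷ v) = (if (a ∧ not b) ∨ (b ∧ not a) then 1 else 0) + hamming u v

adjacent : {n : ℕ} → Vec Bool n → Vec Bool n → Bool
adjacent u v = hamming u v ≡ᵇ 1

-- Edge set of Γ_n^p: unordered pairs of adjacent vertices (each listed once).
edges : (p n : ℕ) → List (Vec Bool n × Vec Bool n)
edges p n = filterᵇ (λ { (u , v) → adjacent u v }) (orderedPairs (vertices p n))

numEdges : (p n : ℕ) → ℕ
numEdges p n = length (edges p n)

degree : (p n : ℕ) → Vec Bool n → ℕ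
degree p n u = length (filterᵇ (adjacent u) (vertices p n))

irr : (p n : ℕ) → ℕ
irr p n = sum (map (λ { (u , v) → ∣ degree p n u - degree p n v ∣ }) (edges p n))

{-# OPTIONS --safe #-}
-- Orient every edge of the hypercube upwards, u ⋖ v, where v arises from u by turning a 0 into a 1.
-- Fibonacci strings are closed downwards, so deg u ≥ deg v on every edge u ⋖ v of Γ_n^p, and irr is
-- the sum of deg u − deg v over these edges. Read strings from the left with the automaton whose
-- state c counts the 0s still owed after the last 1, and let I_c(n) be that sum and E_c(n) the number
-- of edges for the strings accepted from state c, and V(n) the number of strings accepted from state p.
-- Splitting on the first letter gives I_{c+1}(n+1) = I_c(n), E_{c+1}(n+1) = E_c(n),
-- E_0(n+1) = E_0(n) + V(n) + E_p(n) and I_0(n+1) = I_0(n) + I_p(n) + 2 (V(n-1) + ⋯ + V(n-p)), where one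
-- copy of the last sum counts the edges u ⋖ v with u but not v beginning with p 0s, and the other the
-- degree a string beginning with p 0s loses when only such neighbours count. Induction on n then gives
-- I_c(n) = 2 (E_c(n-1) + ⋯ + E_c(n-p)).
module Submission where

open import Defs
open import Data.Bool using (Bool; true; false; _∧_; _∨_; not; if_then_else_)
open import Data.Bool.ListAction using (and)
open import Data.Bool.Properties using (∧-assoc; ∨-zeroʳ)
open import Data.Fin using (Fin; toℕ)
import Data.Fin as Fin
open import Data.List using ([]; _∷_; _++_; map; filterᵇ; length; tabulate; allFin; upTo; applyUpTo)
open import Data.List.Properties using (map-++; map-∘; map-cong; map-tabulate; map-upTo)
open import Data.Nat using (ℕ; zero; suc; pred; _+_; _*_; _∸_; _≤_; _<ᵇ_; _≡ᵇ_; ∣_-_∣; z≤n; s≤s)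
open import Data.Nat.ListAction using (sum)
open import Data.Nat.ListAction.Properties using (sum-++)
open import Data.Nat.Properties
  using (+-identityʳ; +-comm; +-assoc; +-mono-≤; ≤-refl; <⇒≤; pred-mono-≤; n∸n≡0; m≤n⇒m∸n≡0;
         +-∸-comm; +-∸-assoc; ∸-+-assoc; +-commutativeSemigroup; module ≤-Reasoning)
open import Data.Nat.Tactic.RingSolver using (solve-∀)
open import Data.Product using (_×_; _,_)
open import Data.Vec using (Vec; []; _∷_; lookup)
open import Relation.Binary.PropositionalEquality
  using (_≡_; refl; sym; trans; cong; cong₂; subst₂; module ≡-Reasoning)
open import Algebra.Properties.CommutativeSemigroup +-commutativeSemigroup using (interchange)

when : Bool → ℕ → ℕ
when b n = if b then n else 0

𝟙 : Bool → ℕ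
𝟙 b = when b 1

when-0 : ∀ b → when b 0 ≡ 0
when-0 true  = refl
when-0 false = refl

when-+ : ∀ b m n → when b (m + n) ≡ when b m + when b n
when-+ true  m n = refl
when-+ false m n = refl

when-cong : ∀ {b m n} → (b ≡ true → m ≡ n) → when b m ≡ when b n
when-cong {true}  m≡n = m≡n refl
when-cong {false} _   = refl

when-mono : ∀ {a b} n → (a ≡ true → b ≡ true) → when a n ≤ when b n
when-mono {false} n _ = z≤n
when-mono {true}  n a⇒b with refl ← a⇒b refl = ≤-refl

when-+-𝟙 : ∀ {a b} m → (b ≡ true → a ≡ true) → when a (m + 𝟙 b) ≡ when a m + 𝟙 b
when-+-𝟙 {true}          m _   = refl
when-+-𝟙 {false} {false} m _   = refl
when-+-𝟙 {false} {true}  m b⇒a with () ← b⇒a refl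

∣m-n∣≡m∸n+n∸m : ∀ m n → ∣ m - n ∣ ≡ (m ∸ n) + (n ∸ m)
∣m-n∣≡m∸n+n∸m zero    zero    = refl
∣m-n∣≡m∸n+n∸m zero    (suc n) = refl
∣m-n∣≡m∸n+n∸m (suc m) zero    = sym (+-identityʳ (suc m))
∣m-n∣≡m∸n+n∸m (suc m) (suc n) = ∣m-n∣≡m∸n+n∸m m n

[m+n]∸[o+q]≡[m∸o]+[n∸q] : ∀ {m n o q} → o ≤ m → q ≤ n → (m + n) ∸ (o + q) ≡ (m ∸ o) + (n ∸ q)
[m+n]∸[o+q]≡[m∸o]+[n∸q] {m} {n} {o} {q} o≤m q≤n = begin
  (m + n) ∸ (o + q)  ≡⟨ ∸-+-assoc (m + n) o q ⟨
  (m + n) ∸ o ∸ q    ≡⟨ cong (_∸ q) (+-∸-comm n o≤m) ⟩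
  (m ∸ o + n) ∸ q    ≡⟨ +-∸-assoc (m ∸ o) q≤n ⟩
  (m ∸ o) + (n ∸ q)  ∎
  where open ≡-Reasoning

module _ {A : Set} where

  sum-map-cong : ∀ {f g : A → ℕ} → (∀ x → f x ≡ g x) → ∀ xs → sum (map f xs) ≡ sum (map g xs)
  sum-map-cong f≗g xs = cong sum (map-cong f≗g xs)

  sum-map-+ : ∀ (f g : A → ℕ) xs → sum (map (λ x → f x + g x) xs) ≡ sum (map f xs) + sum (map g xs)
  sum-map-+ f g []       = refl
  sum-map-+ f g (x ∷ xs) = trans (cong (f x + g x +_) (sum-map-+ f g xs)) (interchange (f x) (g x) _ _)

  sum-map-filterᵇ : ∀ (P : A → Bool) (f : A → ℕ) xs →
    sum (map f (filterᵇ P xs)) ≡ sum (map (λ x → when (P x) (f x)) xs)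
  sum-map-filterᵇ P f []       = refl
  sum-map-filterᵇ P f (x ∷ xs) with P x
  ... | true  = cong (f x +_) (sum-map-filterᵇ P f xs)
  ... | false = sum-map-filterᵇ P f xs

  length-filterᵇ : ∀ (P : A → Bool) xs → length (filterᵇ P xs) ≡ sum (map (λ x → 𝟙 (P x)) xs)
  length-filterᵇ P []       = refl
  length-filterᵇ P (x ∷ xs) with P x
  ... | true  = cong suc (length-filterᵇ P xs)
  ... | false = length-filterᵇ P xs

  sum-orderedPairs : ∀ (h : A → A → ℕ) → (∀ x → h x x ≡ 0) → ∀ xs →
    sum (map (λ (x , y) → h x y + h y x) (orderedPairs xs)) ≡ sum (map (λ x → sum (map (h x) xs)) xs)
  sum-orderedPairs h h-diag []       = refl
  sum-orderedPairs h h-diag (x ∷ xs) = begin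
    sum (map φ (map (x ,_) xs ++ orderedPairs xs))
      ≡⟨ cong sum (map-++ φ (map (x ,_) xs) (orderedPairs xs)) ⟩
    sum (map φ (map (x ,_) xs) ++ map φ (orderedPairs xs))
      ≡⟨ sum-++ (map φ (map (x ,_) xs)) _ ⟩
    sum (map φ (map (x ,_) xs)) + sum (map φ (orderedPairs xs))
      ≡⟨ cong₂ _+_ (trans (sym (cong sum (map-∘ xs))) (sum-map-+ (h x) (λ y → h y x) xs))
                   (sum-orderedPairs h h-diag xs) ⟩
    (sum (map (h x) xs) + sum (map (λ y → h y x) xs)) + sum (map (λ z → sum (map (h z) xs)) xs)
      ≡⟨ +-assoc (sum (map (h x) xs)) _ _ ⟩
    sum (map (h x) xs) + (sum (map (λ y → h y x) xs) + sum (map (λ z → sum (map (h z) xs)) xs))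
      ≡⟨ cong₂ _+_ (cong (_+ sum (map (h x) xs)) (h-diag x))
                   (sum-map-+ (λ z → h z x) (λ z → sum (map (h z) xs)) xs) ⟨
    (h x x + sum (map (h x) xs)) + sum (map (λ z → h z x + sum (map (h z) xs)) xs)
      ∎
    where
    open ≡-Reasoning
    φ : A × A → ℕ
    φ (x , y) = h x y + h y x

  and-orderedPairs-∷ : ∀ (G : A × A → Bool) x xs →
    and (map G (orderedPairs (x ∷ xs))) ≡ and (map (λ y → G (x , y)) xs) ∧ and (map G (orderedPairs xs))
  and-orderedPairs-∷ G x xs = begin
    and (map G (map (x ,_) xs ++ orderedPairs xs))        ≡⟨ cong and (map-++ G (map (x ,_) xs) _) ⟩
    and (map G (map (x ,_) xs) ++ map G (orderedPairs xs)) ≡⟨ and-++ (map G (map (x ,_) xs)) _ ⟩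
    and (map G (map (x ,_) xs)) ∧ and (map G (orderedPairs xs)) ≡⟨ cong (λ ys → and ys ∧ _) (map-∘ xs) ⟨
    and (map (λ y → G (x , y)) xs) ∧ and (map G (orderedPairs xs)) ∎
    where
    open ≡-Reasoning
    and-++ : ∀ bs cs → and (bs ++ cs) ≡ and bs ∧ and cs
    and-++ []       cs = refl
    and-++ (b ∷ bs) cs = trans (cong (b ∧_) (and-++ bs cs)) (sym (∧-assoc b _ _))

  orderedPairs-map : ∀ {B : Set} (f : A → B) xs →
    orderedPairs (map f xs) ≡ map (λ (x , y) → (f x , f y)) (orderedPairs xs)
  orderedPairs-map f []       = refl
  orderedPairs-map f (x ∷ xs) = trans
    (cong₂ _++_ (trans (sym (map-∘ xs)) (map-∘ xs)) (orderedPairs-map f xs))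
    (sym (map-++ _ (map (x ,_) xs) (orderedPairs xs)))

and-tabulate-true : ∀ {n} {f : Fin n → Bool} → (∀ j → f j ≡ true) → and (tabulate f) ≡ true
and-tabulate-true {zero}  _     = refl
and-tabulate-true {suc n} f≡true = cong₂ _∧_ (f≡true Fin.zero) (and-tabulate-true (λ j → f≡true (Fin.suc j)))

-- window f c m = f (m - 1) + ⋯ + f (m - c), without the terms of negative argument.
window : (ℕ → ℕ) → ℕ → ℕ → ℕ
window f zero    m       = 0
window f (suc c) zero    = 0
window f (suc c) (suc m) = f m + window f c m

window-zeroʳ : ∀ f c → window f c 0 ≡ 0
window-zeroʳ f zero    = refl
window-zeroʳ f (suc c) = refl

window-shift : ∀ {f g : ℕ → ℕ} → g 0 ≡ 0 → (∀ m → g (suc m) ≡ f m) →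
  ∀ c m → window g c (suc m) ≡ window f c m
window-shift g0 gs zero    m       = refl
window-shift g0 gs (suc c) zero    = cong₂ _+_ g0 (window-zeroʳ _ c)
window-shift g0 gs (suc c) (suc m) = cong₂ _+_ (gs m) (window-shift g0 gs c m)

window-+ : ∀ (f g : ℕ → ℕ) c m → window (λ k → f k + g k) c m ≡ window f c m + window g c m
window-+ f g zero    m       = refl
window-+ f g (suc c) zero    = refl
window-+ f g (suc c) (suc m) = trans (cong (f m + g m +_) (window-+ f g c m)) (interchange (f m) (g m) _ _)

window-unique : ∀ {X : ℕ → ℕ → ℕ} {f : ℕ → ℕ} {b} →
  (∀ m → X 0 m ≡ 0) → (∀ c → X (suc c) 0 ≡ 0) →
  (∀ {c} m → suc c ≤ b → X (suc c) (suc m) ≡ X c m + f m) →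
  ∀ {c} m → c ≤ b → X c m ≡ window f c m
window-unique X0 Xs0 Xss {zero}  m       _   = X0 m
window-unique X0 Xs0 Xss {suc c} zero    _   = Xs0 c
window-unique {f = f} X0 Xs0 Xss {suc c} (suc m) c<b =
  trans (Xss m c<b) (trans (cong (_+ f m) (window-unique X0 Xs0 Xss m (<⇒≤ c<b))) (+-comm _ (f m)))

window≡sum-upTo : ∀ {f : ℕ → ℕ} → f 0 ≡ 0 → ∀ c m →
  window f c m ≡ sum (map (λ k → f (m ∸ suc k)) (upTo c))
window≡sum-upTo {f} f0 c m = sym (trans (cong sum (map-upTo _ c)) (sum-applyUpTo c m))
  where
  sum-applyUpTo : ∀ c m → sum (applyUpTo (λ k → f (m ∸ suc k)) c) ≡ window f c m
  sum-applyUpTo zero    m       = refl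
  sum-applyUpTo (suc c) zero    = cong₂ _+_ f0 (trans (sum-applyUpTo c zero) (window-zeroʳ f c))
  sum-applyUpTo (suc c) (suc m) = cong (f m +_) (sum-applyUpTo c m)

∑ : ∀ {n} → (Vec Bool n → ℕ) → ℕ
∑ {zero}  f = f []
∑ {suc n} f = ∑ (λ w → f (false ∷ w)) + ∑ (λ w → f (true ∷ w))

∑≡sum-allStrings : ∀ {n} (f : Vec Bool n → ℕ) → ∑ f ≡ sum (map f (allStrings n))
∑≡sum-allStrings {zero}  f = sym (+-identityʳ (f []))
∑≡sum-allStrings {suc n} f = begin
  ∑ (λ w → f (false ∷ w)) + ∑ (λ w → f (true ∷ w))
    ≡⟨ cong₂ _+_ (∑≡sum-allStrings {n} _) (∑≡sum-allStrings {n} _) ⟩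
  sum (map (λ w → f (false ∷ w)) ws) + sum (map (λ w → f (true ∷ w)) ws)
    ≡⟨ cong₂ _+_ (cong sum (map-∘ ws)) (cong sum (map-∘ ws)) ⟩
  sum (map f (map (false ∷_) ws)) + sum (map f (map (true ∷_) ws))
    ≡⟨ sum-++ (map f (map (false ∷_) ws)) _ ⟨
  sum (map f (map (false ∷_) ws) ++ map f (map (true ∷_) ws))
    ≡⟨ cong sum (map-++ f (map (false ∷_) ws) _) ⟨
  sum (map f (allStrings (suc n)))
    ∎
  where
  open ≡-Reasoning
  ws = allStrings n

∑-cong : ∀ {n} {f g : Vec Bool n → ℕ} → (∀ w → f w ≡ g w) → ∑ f ≡ ∑ g
∑-cong {zero}  f≗g = f≗g []
∑-cong {suc n} f≗g = cong₂ _+_ (∑-cong λ w → f≗g (false ∷ w)) (∑-cong λ w → f≗g (true ∷ w))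

∑-zero : ∀ {n} {f : Vec Bool n → ℕ} → (∀ w → f w ≡ 0) → ∑ f ≡ 0
∑-zero {zero}  f≗0 = f≗0 []
∑-zero {suc n} f≗0 = cong₂ _+_ (∑-zero λ w → f≗0 (false ∷ w)) (∑-zero λ w → f≗0 (true ∷ w))

∑-+ : ∀ {n} (f g : Vec Bool n → ℕ) → ∑ (λ w → f w + g w) ≡ ∑ f + ∑ g
∑-+ {zero}  f g = refl
∑-+ {suc n} f g = trans
  (cong₂ _+_ (∑-+ (λ w → f (false ∷ w)) (λ w → g (false ∷ w)))
             (∑-+ (λ w → f (true ∷ w)) (λ w → g (true ∷ w))))
  (interchange (∑ λ w → f (false ∷ w)) _ _ _)

∑-mono : ∀ {n} {f g : Vec Bool n → ℕ} → (∀ w → f w ≤ g w) → ∑ f ≤ ∑ g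
∑-mono {zero}  f≤g = f≤g []
∑-mono {suc n} f≤g = +-mono-≤ (∑-mono λ w → f≤g (false ∷ w)) (∑-mono λ w → f≤g (true ∷ w))

∑-δ : ∀ {n} (u : Vec Bool n) (g : Vec Bool n → Bool → ℕ) → (∀ w → g w false ≡ 0) →
      ∑ (λ w → g w (hamming u w ≡ᵇ 0)) ≡ g u true
∑-δ []          g g0 = refl
∑-δ (false ∷ u) g g0 = trans
  (cong₂ _+_ (∑-δ u (λ w → g (false ∷ w)) (λ w → g0 (false ∷ w))) (∑-zero λ w → g0 (true ∷ w)))
  (+-identityʳ _)
∑-δ (true ∷ u)  g g0 =
  cong₂ _+_ (∑-zero λ w → g0 (false ∷ w)) (∑-δ u (λ w → g (true ∷ w)) (λ w → g0 (true ∷ w)))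

when-∑ : ∀ {n} b (f : Vec Bool n → ℕ) → when b (∑ f) ≡ ∑ (λ w → when b (f w))
when-∑ true  f = refl
when-∑ {n} false f = sym (∑-zero {n} λ _ → refl)

∑₂ : ∀ {n} → (Vec Bool n → Vec Bool n → ℕ) → ℕ
∑₂ f = ∑ λ u → ∑ λ v → f u v

∑₂-zero : ∀ {n} {f : Vec Bool n → Vec Bool n → ℕ} → (∀ u v → f u v ≡ 0) → ∑₂ f ≡ 0
∑₂-zero f≗0 = ∑-zero λ u → ∑-zero (f≗0 u)

∑₂-+ : ∀ {n} (f g : Vec Bool n → Vec Bool n → ℕ) → ∑₂ (λ u v → f u v + g u v) ≡ ∑₂ f + ∑₂ g
∑₂-+ {n} f g = trans (∑-cong λ u → ∑-+ (f u) (g u)) (∑-+ {n} _ _)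

∑₂-∷ : ∀ {n} (f : Vec Bool (suc n) → Vec Bool (suc n) → ℕ) →
  ∑₂ f ≡ (∑₂ (λ u v → f (false ∷ u) (false ∷ v)) + ∑₂ (λ u v → f (false ∷ u) (true ∷ v)))
       + (∑₂ (λ u v → f (true ∷ u) (false ∷ v)) + ∑₂ (λ u v → f (true ∷ u) (true ∷ v)))
∑₂-∷ {n} f = cong₂ _+_ (∑-+ {n} _ _) (∑-+ {n} _ _)

hamming-comm : ∀ {n} (u v : Vec Bool n) → hamming u v ≡ hamming v u
hamming-comm []          []          = refl
hamming-comm (false ∷ u) (false ∷ v) = hamming-comm u v
hamming-comm (false ∷ u) (true ∷ v)  = cong suc (hamming-comm u v)
hamming-comm (true ∷ u)  (false ∷ v) = cong suc (hamming-comm u v)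
hamming-comm (true ∷ u)  (true ∷ v)  = hamming-comm u v

hamming-self : ∀ {n} (u : Vec Bool n) → hamming u u ≡ 0
hamming-self []          = refl
hamming-self (false ∷ u) = hamming-self u
hamming-self (true ∷ u)  = hamming-self u

hamming≡0⇒≡ : ∀ {n} (u v : Vec Bool n) → (hamming u v ≡ᵇ 0) ≡ true → u ≡ v
hamming≡0⇒≡ []          []          _  = refl
hamming≡0⇒≡ (false ∷ u) (false ∷ v) h≡0 = cong (false ∷_) (hamming≡0⇒≡ u v h≡0)
hamming≡0⇒≡ (true ∷ u)  (true ∷ v)  h≡0 = cong (true ∷_) (hamming≡0⇒≡ u v h≡0)
hamming≡0⇒≡ (false ∷ u) (true ∷ v)  ()
hamming≡0⇒≡ (true ∷ u)  (false ∷ v) ()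

adjacent-comm : ∀ {n} (u v : Vec Bool n) → adjacent u v ≡ adjacent v u
adjacent-comm u v = cong (_≡ᵇ 1) (hamming-comm u v)

adjacent-irrefl : ∀ {n} (u : Vec Bool n) → adjacent u u ≡ false
adjacent-irrefl u = cong (_≡ᵇ 1) (hamming-self u)

infix 7 _⋖ᵇ_

_⋖ᵇ_ : ∀ {n} → Vec Bool n → Vec Bool n → Bool
[]          ⋖ᵇ []          = false
(false ∷ u) ⋖ᵇ (false ∷ v) = u ⋖ᵇ v
(false ∷ u) ⋖ᵇ (true ∷ v)  = hamming u v ≡ᵇ 0
(true ∷ u)  ⋖ᵇ (false ∷ v) = false
(true ∷ u)  ⋖ᵇ (true ∷ v)  = u ⋖ᵇ v

⋖ᵇ-irrefl : ∀ {n} (u : Vec Bool n) → u ⋖ᵇ u ≡ false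
⋖ᵇ-irrefl []          = refl
⋖ᵇ-irrefl (false ∷ u) = ⋖ᵇ-irrefl u
⋖ᵇ-irrefl (true ∷ u)  = ⋖ᵇ-irrefl u

𝟙-adjacent : ∀ {n} (u v : Vec Bool n) → 𝟙 (adjacent u v) ≡ 𝟙 (u ⋖ᵇ v) + 𝟙 (v ⋖ᵇ u)
𝟙-adjacent []          []          = refl
𝟙-adjacent (false ∷ u) (false ∷ v) = 𝟙-adjacent u v
𝟙-adjacent (false ∷ u) (true ∷ v)  = sym (+-identityʳ _)
𝟙-adjacent (true ∷ u)  (false ∷ v) = cong (λ h → 𝟙 (h ≡ᵇ 0)) (hamming-comm u v)
𝟙-adjacent (true ∷ u)  (true ∷ v)  = 𝟙-adjacent u v

module FibonacciCube (p : ℕ) where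

  -- fib c v: v is a Fibonacci p-string beginning with at least c 0s, i.e. it is accepted from the
  -- automaton state c (the number of 0s still owed after the last 1).
  fib : ∀ {n} → ℕ → Vec Bool n → Bool
  fib c       []          = true
  fib c       (false ∷ v) = fib (pred c) v
  fib zero    (true ∷ v)  = fib p v
  fib (suc c) (true ∷ v)  = false

  fib-antitone : ∀ {n c d} (v : Vec Bool n) → c ≤ d → fib d v ≡ true → fib c v ≡ true
  fib-antitone             []          _   _  = refl
  fib-antitone             (false ∷ v) c≤d fv = fib-antitone v (pred-mono-≤ c≤d) fv
  fib-antitone {d = zero}  (true ∷ v)  z≤n fv = fv
  fib-antitone {d = suc d} (true ∷ v)  _   ()

  fib-⋖ : ∀ {n} c (u v : Vec Bool n) → u ⋖ᵇ v ≡ true → fib c v ≡ true → fib c u ≡ true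
  fib-⋖ c       (false ∷ u) (false ∷ v) u⋖v fv = fib-⋖ (pred c) u v u⋖v fv
  fib-⋖ zero    (true ∷ u)  (true ∷ v)  u⋖v fv = fib-⋖ p u v u⋖v fv
  fib-⋖ zero    (false ∷ u) (true ∷ v)  u⋖v fv with refl ← hamming≡0⇒≡ u v u⋖v = fib-antitone u z≤n fv
  fib-⋖ (suc c) (_ ∷ u)     (true ∷ v)  _   ()
  fib-⋖ c       (true ∷ u)  (false ∷ v) ()  _
  fib-⋖ c       []          []          ()  _

  isFibString-∷ : ∀ {n} b (v : Vec Bool n) → isFibString p (suc n) (b ∷ v) ≡
    and (tabulate (λ j → not (b ∧ lookup v j) ∨ (p <ᵇ suc (toℕ j)))) ∧ isFibString p n v
  isFibString-∷ {n} b v = begin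
    and (map G (orderedPairs (allFin (suc n))))
      ≡⟨ and-orderedPairs-∷ G Fin.zero (tabulate Fin.suc) ⟩
    and (map (λ j → G (Fin.zero , j)) (tabulate Fin.suc)) ∧ and (map G (orderedPairs (tabulate Fin.suc)))
      ≡⟨ cong₂ _∧_ (cong and (map-tabulate Fin.suc (λ j → G (Fin.zero , j))))
                   (sym (cong (λ is → and (map G (orderedPairs is))) (map-tabulate (λ i → i) Fin.suc))) ⟩
    and (tabulate (λ j → G (Fin.zero , Fin.suc j))) ∧ and (map G (orderedPairs (map Fin.suc (allFin n))))
      ≡⟨ cong (λ ijs → and (tabulate (λ j → G (Fin.zero , Fin.suc j))) ∧ and ijs)
              (trans (cong (map G) (orderedPairs-map Fin.suc (allFin n))) (sym (map-∘ _))) ⟩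
    and (tabulate (λ j → not (b ∧ lookup v j) ∨ (p <ᵇ suc (toℕ j)))) ∧ isFibString p n v
      ∎
    where
    open ≡-Reasoning
    G : Fin (suc n) × Fin (suc n) → Bool
    G (i , j) = not (lookup (b ∷ v) i ∧ lookup (b ∷ v) j) ∨ (p <ᵇ (toℕ j ∸ toℕ i))

  zerosBefore : ∀ {n} → ℕ → Vec Bool n → Bool
  zerosBefore c v = and (tabulate (λ j → not (lookup v j) ∨ (c <ᵇ suc (toℕ j))))

  zerosBefore∧fib0≡fib : ∀ {n} c (v : Vec Bool n) → zerosBefore c v ∧ fib 0 v ≡ fib c v
  zerosBefore∧fib0≡fib zero    v           =
    cong (_∧ fib 0 v) (and-tabulate-true (λ j → ∨-zeroʳ (not (lookup v j))))
  zerosBefore∧fib0≡fib (suc c) []          = refl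
  zerosBefore∧fib0≡fib (suc c) (false ∷ v) = zerosBefore∧fib0≡fib c v
  zerosBefore∧fib0≡fib (suc c) (true ∷ v)  = refl

  isFibString≡fib : ∀ {n} (v : Vec Bool n) → isFibString p n v ≡ fib 0 v
  isFibString≡fib []          = refl
  isFibString≡fib {suc n} (false ∷ v) = trans (isFibString-∷ false v)
    (trans (cong (_∧ isFibString p n v) (and-tabulate-true {n} (λ _ → refl))) (isFibString≡fib v))
  isFibString≡fib (true ∷ v)  = trans (isFibString-∷ true v)
    (trans (cong (zerosBefore p v ∧_) (isFibString≡fib v)) (zerosBefore∧fib0≡fib p v))

  deg : ∀ {n} → ℕ → Vec Bool n → ℕ
  deg c u = ∑ λ w → when (fib c w) (𝟙 (adjacent u w))

  degree≡deg : ∀ {n} (u : Vec Bool n) → degree p n u ≡ deg 0 u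
  degree≡deg {n} u = begin
    length (filterᵇ (adjacent u) (vertices p n))
      ≡⟨ length-filterᵇ (adjacent u) (vertices p n) ⟩
    sum (map (λ w → 𝟙 (adjacent u w)) (vertices p n))
      ≡⟨ sum-map-filterᵇ (isFibString p n) (λ w → 𝟙 (adjacent u w)) (allStrings n) ⟩
    sum (map (λ w → when (isFibString p n w) (𝟙 (adjacent u w))) (allStrings n))
      ≡⟨ ∑≡sum-allStrings {n} _ ⟨
    ∑ (λ w → when (isFibString p n w) (𝟙 (adjacent u w)))
      ≡⟨ ∑-cong {n} (λ w → cong (λ b → when b (𝟙 (adjacent u w))) (isFibString≡fib w)) ⟩
    deg 0 u
      ∎
    where open ≡-Reasoning

  deg-zero-false∷ : ∀ {n} (u : Vec Bool n) → deg 0 (false ∷ u) ≡ deg 0 u + 𝟙 (fib p u)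
  deg-zero-false∷ u =
    cong (deg 0 u +_) (∑-δ u (λ w b → when (fib p w) (𝟙 b)) (λ w → when-0 (fib p w)))

  deg-zero-true∷ : ∀ {n} (u : Vec Bool n) → deg 0 (true ∷ u) ≡ 𝟙 (fib 0 u) + deg p u
  deg-zero-true∷ u =
    cong (_+ deg p u) (∑-δ u (λ w b → when (fib 0 w) (𝟙 b)) (λ w → when-0 (fib 0 w)))

  deg-suc-false∷ : ∀ {n} c (u : Vec Bool n) → deg (suc c) (false ∷ u) ≡ deg c u
  deg-suc-false∷ {n} c u = trans (cong (deg c u +_) (∑-zero {n} λ _ → refl)) (+-identityʳ _)

  deg-antitone-state : ∀ {n c d} (w : Vec Bool n) → c ≤ d → deg d w ≤ deg c w
  deg-antitone-state {n} w c≤d = ∑-mono {n} λ x → when-mono _ (fib-antitone x c≤d)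

  deg-antitone-⋖ : ∀ {n} c (u v : Vec Bool n) → u ⋖ᵇ v ≡ true → fib c u ≡ true → fib c v ≡ true →
    deg c v ≤ deg c u
  deg-antitone-⋖ zero (false ∷ u) (false ∷ v) u⋖v fu fv = begin
    deg 0 (false ∷ v)      ≡⟨ deg-zero-false∷ v ⟩
    deg 0 v + 𝟙 (fib p v)  ≤⟨ +-mono-≤ (deg-antitone-⋖ 0 u v u⋖v fu fv) (when-mono 1 (fib-⋖ p u v u⋖v)) ⟩
    deg 0 u + 𝟙 (fib p u)  ≡⟨ deg-zero-false∷ u ⟨
    deg 0 (false ∷ u)      ∎
    where open ≤-Reasoning
  deg-antitone-⋖ (suc c) (false ∷ u) (false ∷ v) u⋖v fu fv =
    subst₂ _≤_ (sym (deg-suc-false∷ c v)) (sym (deg-suc-false∷ c u)) (deg-antitone-⋖ c u v u⋖v fu fv)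
  deg-antitone-⋖ zero (false ∷ u) (true ∷ v) u⋖v fu fv with refl ← hamming≡0⇒≡ u v u⋖v = begin
    deg 0 (true ∷ u)       ≡⟨ deg-zero-true∷ u ⟩
    𝟙 (fib 0 u) + deg p u  ≡⟨ cong (λ b → 𝟙 b + deg p u) fu ⟩
    1 + deg p u            ≤⟨ s≤s (deg-antitone-state u z≤n) ⟩
    1 + deg 0 u            ≡⟨ +-comm 1 (deg 0 u) ⟩
    deg 0 u + 1            ≡⟨ cong (λ b → deg 0 u + 𝟙 b) fv ⟨
    deg 0 u + 𝟙 (fib p u)  ≡⟨ deg-zero-false∷ u ⟨
    deg 0 (false ∷ u)      ∎
    where open ≤-Reasoning
  deg-antitone-⋖ zero (true ∷ u) (true ∷ v) u⋖v fu fv = begin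
    deg 0 (true ∷ v)       ≡⟨ deg-zero-true∷ v ⟩
    𝟙 (fib 0 v) + deg p v  ≤⟨ +-mono-≤ (when-mono 1 (fib-⋖ 0 u v u⋖v)) (deg-antitone-⋖ p u v u⋖v fu fv) ⟩
    𝟙 (fib 0 u) + deg p u  ≡⟨ deg-zero-true∷ u ⟨
    deg 0 (true ∷ u)       ∎
    where open ≤-Reasoning
  deg-antitone-⋖ (suc c) (true ∷ u)  (true ∷ v)  _  () _
  deg-antitone-⋖ (suc c) (false ∷ u) (true ∷ v)  _  _  ()
  deg-antitone-⋖ c       (true ∷ u)  (false ∷ v) () _  _
  deg-antitone-⋖ c       []          []          () _  _

  when-adjacent≡when-⋖ : ∀ {n} c (u v : Vec Bool n) → fib c u ≡ true → fib c v ≡ true →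
    when (adjacent u v) (deg c u ∸ deg c v) ≡ when (u ⋖ᵇ v) (deg c u ∸ deg c v)
  when-adjacent≡when-⋖ c u v fu fv with adjacent u v | u ⋖ᵇ v | v ⋖ᵇ u in v⋖u | 𝟙-adjacent u v
  ... | true  | true  | _     | _  = refl
  ... | true  | false | true  | _  = m≤n⇒m∸n≡0 (deg-antitone-⋖ c v u v⋖u fv fu)
  ... | false | false | _     | _  = refl
  ... | true  | false | false | ()
  ... | false | true  | _     | ()

  -- The guard omits fib c u, which follows from u ⋖ v and fib c v (fib-⋖).
  edgeSum : ∀ {n} → ℕ → (Vec Bool n → Vec Bool n → ℕ) → ℕ
  edgeSum c φ = ∑₂ λ u v → when (fib c v) (when (u ⋖ᵇ v) (φ u v))

  edgeSum-cong : ∀ {n} c {φ ψ : Vec Bool n → Vec Bool n → ℕ} →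
    (∀ u v → u ⋖ᵇ v ≡ true → fib c u ≡ true → fib c v ≡ true → φ u v ≡ ψ u v) →
    edgeSum c φ ≡ edgeSum c ψ
  edgeSum-cong {n} c φ≡ψ = ∑-cong {n} λ u → ∑-cong λ v →
    when-cong λ fv → when-cong λ u⋖v → φ≡ψ u v u⋖v (fib-⋖ c u v u⋖v fv) fv

  edgeSum-zero : ∀ {n} c {φ : Vec Bool n → Vec Bool n → ℕ} →
    (∀ u v → u ⋖ᵇ v ≡ true → fib c u ≡ true → fib c v ≡ true → φ u v ≡ 0) → edgeSum c φ ≡ 0
  edgeSum-zero {n} c φ≡0 = trans (edgeSum-cong c φ≡0)
    (∑₂-zero {n} λ u v → trans (cong (when (fib c v)) (when-0 (u ⋖ᵇ v))) (when-0 (fib c v)))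

  edgeSum-+ : ∀ {n} c (φ ψ : Vec Bool n → Vec Bool n → ℕ) →
    edgeSum c (λ u v → φ u v + ψ u v) ≡ edgeSum c φ + edgeSum c ψ
  edgeSum-+ {n} c φ ψ = trans
    (∑-cong {n} λ u → ∑-cong λ v →
      trans (cong (when (fib c v)) (when-+ (u ⋖ᵇ v) (φ u v) (ψ u v))) (when-+ (fib c v) _ _))
    (∑₂-+ (λ u v → when (fib c v) (when (u ⋖ᵇ v) (φ u v)))
          (λ u v → when (fib c v) (when (u ⋖ᵇ v) (ψ u v))))

  edgeSum-suc : ∀ {n} c (φ : Vec Bool (suc n) → Vec Bool (suc n) → ℕ) →
    edgeSum (suc c) φ ≡ edgeSum c (λ u v → φ (false ∷ u) (false ∷ v))
  edgeSum-suc {n} c φ = trans (∑₂-∷ (λ u v → when (fib (suc c) v) (when (u ⋖ᵇ v) (φ u v)))) (trans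
    (cong₂ _+_ (cong (edgeSum c (λ u v → φ (false ∷ u) (false ∷ v)) +_) (∑₂-zero {n} λ _ _ → refl))
               (cong₂ _+_ (∑₂-zero {n} λ _ v → when-0 (fib c v)) (∑₂-zero {n} λ _ _ → refl)))
    (trans (+-identityʳ _) (+-identityʳ _)))

  edgeSum-zero-suc : ∀ {n} (φ : Vec Bool (suc n) → Vec Bool (suc n) → ℕ) →
    edgeSum 0 φ ≡ edgeSum 0 (λ u v → φ (false ∷ u) (false ∷ v))
                + ∑ (λ u → when (fib p u) (φ (false ∷ u) (true ∷ u)))
                + edgeSum p (λ u v → φ (true ∷ u) (true ∷ v))
  edgeSum-zero-suc {n} φ = trans (∑₂-∷ (λ u v → when (fib 0 v) (when (u ⋖ᵇ v) (φ u v)))) (cong₂ _+_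
    (cong (edgeSum 0 (λ u v → φ (false ∷ u) (false ∷ v)) +_) (∑-cong {n} λ u →
      ∑-δ u (λ v b → when (fib p v) (when b (φ (false ∷ u) (true ∷ v)))) (λ v → when-0 (fib p v))))
    (cong (_+ edgeSum p (λ u v → φ (true ∷ u) (true ∷ v))) (∑₂-zero {n} λ _ v → when-0 (fib 0 v))))

  ∑₂-fib≡edgeSum : ∀ {n} c (h φ : Vec Bool n → Vec Bool n → ℕ) →
    (∀ u v → fib c u ≡ true → fib c v ≡ true → h u v ≡ when (u ⋖ᵇ v) (φ u v)) →
    ∑₂ (λ u v → when (fib c u) (when (fib c v) (h u v))) ≡ edgeSum c φ
  ∑₂-fib≡edgeSum {n} c h φ h≡ = ∑-cong {n} λ u → ∑-cong λ v → pointwise u v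
    where
    pointwise : ∀ u v → when (fib c u) (when (fib c v) (h u v)) ≡ when (fib c v) (when (u ⋖ᵇ v) (φ u v))
    pointwise u v with fib c u in fu | fib c v in fv
    ... | true  | true  = h≡ u v fu fv
    ... | true  | false = refl
    ... | false | false = refl
    ... | false | true with u ⋖ᵇ v in u⋖v
    ...   | false = refl
    ...   | true with () ← trans (sym fu) (fib-⋖ c u v u⋖v fv)

  sum-orderedPairs-vertices : ∀ {n} (h : Vec Bool n → Vec Bool n → ℕ) → (∀ u → h u u ≡ 0) →
    sum (map (λ (u , v) → h u v + h v u) (orderedPairs (vertices p n)))
      ≡ ∑₂ (λ u v → when (fib 0 u) (when (fib 0 v) (h u v)))
  sum-orderedPairs-vertices {n} h h-diag = begin
    sum (map (λ (u , v) → h u v + h v u) (orderedPairs V))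
      ≡⟨ sum-orderedPairs h h-diag V ⟩
    sum (map (λ u → sum (map (h u) V)) V)
      ≡⟨ sum-map-filterᵇ (isFibString p n) _ (allStrings n) ⟩
    sum (map (λ u → when (isFibString p n u) (sum (map (h u) V))) (allStrings n))
      ≡⟨ ∑≡sum-allStrings {n} _ ⟨
    ∑ (λ u → when (isFibString p n u) (sum (map (h u) V)))
      ≡⟨ ∑-cong {n} (λ u → cong (when _) (sum-map-filterᵇ (isFibString p n) (h u) (allStrings n))) ⟩
    ∑ (λ u → when (isFibString p n u) (sum (map (λ v → when (isFibString p n v) (h u v)) (allStrings n))))
      ≡⟨ ∑-cong {n} (λ u → cong (when _) (∑≡sum-allStrings {n} _)) ⟨
    ∑ (λ u → when (isFibString p n u) (∑ λ v → when (isFibString p n v) (h u v)))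
      ≡⟨ ∑-cong {n} (λ u → when-∑ {n} (isFibString p n u) _) ⟩
    ∑₂ (λ u v → when (isFibString p n u) (when (isFibString p n v) (h u v)))
      ≡⟨ ∑-cong {n} (λ u → ∑-cong λ v →
           cong₂ (λ a b → when a (when b (h u v))) (isFibString≡fib u) (isFibString≡fib v)) ⟩
    ∑₂ (λ u v → when (fib 0 u) (when (fib 0 v) (h u v)))
      ∎
    where
    open ≡-Reasoning
    V = vertices p n

  vertexCount : ℕ → ℕ → ℕ
  vertexCount c n = ∑ {n} λ w → 𝟙 (fib c w)

  edgeCount : ℕ → ℕ → ℕ
  edgeCount c n = edgeSum {n} c λ _ _ → 1

  irrSum : ℕ → ℕ → ℕ
  irrSum c n = edgeSum {n} c λ u v → deg c u ∸ deg c v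

  crossingCount : ℕ → ℕ → ℕ
  crossingCount c n = edgeSum {n} 0 λ u v → 𝟙 (fib c u) ∸ 𝟙 (fib c v)

  degreeDeficit : ℕ → ℕ → ℕ
  degreeDeficit c n = ∑ {n} λ w → when (fib c w) (deg 0 w ∸ deg c w)

  edgeCount-suc : ∀ c n → edgeCount (suc c) (suc n) ≡ edgeCount c n
  edgeCount-suc c n = edgeSum-suc {n} c λ _ _ → 1

  edgeCount-zero-suc : ∀ n → edgeCount 0 (suc n) ≡ edgeCount 0 n + vertexCount p n + edgeCount p n
  edgeCount-zero-suc n = edgeSum-zero-suc {n} λ _ _ → 1

  irrSum-suc : ∀ c n → irrSum (suc c) (suc n) ≡ irrSum c n
  irrSum-suc c n = trans (edgeSum-suc {n} c λ u v → deg (suc c) u ∸ deg (suc c) v)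
    (edgeSum-cong {n} c λ u v _ _ _ → cong₂ _∸_ (deg-suc-false∷ c u) (deg-suc-false∷ c v))

  irrSum-zero-suc : ∀ n → irrSum 0 (suc n) ≡ irrSum 0 n + crossingCount p n + degreeDeficit p n + irrSum p n
  irrSum-zero-suc n = trans (edgeSum-zero-suc {n} λ u v → deg 0 u ∸ deg 0 v) (cong₂ _+_ (cong₂ _+_
    (trans (edgeSum-cong {n} 0 lower)
      (edgeSum-+ {n} 0 (λ u v → deg 0 u ∸ deg 0 v) (λ u v → 𝟙 (fib p u) ∸ 𝟙 (fib p v))))
    (∑-cong {n} λ u → when-cong (flip u)))
    (edgeSum-cong {n} p upper))
    where
    open ≡-Reasoning
    lower : ∀ (u v : Vec Bool n) → u ⋖ᵇ v ≡ true → fib 0 u ≡ true → fib 0 v ≡ true →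
      deg 0 (false ∷ u) ∸ deg 0 (false ∷ v) ≡ (deg 0 u ∸ deg 0 v) + (𝟙 (fib p u) ∸ 𝟙 (fib p v))
    lower u v u⋖v fu fv = begin
      deg 0 (false ∷ u) ∸ deg 0 (false ∷ v)
        ≡⟨ cong₂ _∸_ (deg-zero-false∷ u) (deg-zero-false∷ v) ⟩
      (deg 0 u + 𝟙 (fib p u)) ∸ (deg 0 v + 𝟙 (fib p v))
        ≡⟨ [m+n]∸[o+q]≡[m∸o]+[n∸q] (deg-antitone-⋖ 0 u v u⋖v fu fv) (when-mono 1 (fib-⋖ p u v u⋖v)) ⟩
      (deg 0 u ∸ deg 0 v) + (𝟙 (fib p u) ∸ 𝟙 (fib p v))
        ∎
    flip : ∀ (u : Vec Bool n) → fib p u ≡ true → deg 0 (false ∷ u) ∸ deg 0 (true ∷ u) ≡ deg 0 u ∸ deg p u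
    flip u fu = begin
      deg 0 (false ∷ u) ∸ deg 0 (true ∷ u)
        ≡⟨ cong₂ _∸_ (deg-zero-false∷ u) (deg-zero-true∷ u) ⟩
      (deg 0 u + 𝟙 (fib p u)) ∸ (𝟙 (fib 0 u) + deg p u)
        ≡⟨ cong₂ (λ a b → (deg 0 u + 𝟙 a) ∸ (𝟙 b + deg p u)) fu (fib-antitone u z≤n fu) ⟩
      (deg 0 u + 1) ∸ (1 + deg p u)
        ≡⟨ cong (_∸ (1 + deg p u)) (+-comm (deg 0 u) 1) ⟩
      deg 0 u ∸ deg p u
        ∎
    upper : ∀ (u v : Vec Bool n) → u ⋖ᵇ v ≡ true → fib p u ≡ true → fib p v ≡ true →
      deg 0 (true ∷ u) ∸ deg 0 (true ∷ v) ≡ deg p u ∸ deg p v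
    upper u v _ fu fv = trans (cong₂ _∸_ (deg-zero-true∷ u) (deg-zero-true∷ v))
      (cong₂ (λ a b → (𝟙 a + deg p u) ∸ (𝟙 b + deg p v)) (fib-antitone u z≤n fu) (fib-antitone v z≤n fv))

  crossingCount-zero : ∀ n → crossingCount 0 n ≡ 0
  crossingCount-zero n = edgeSum-zero {n} 0 λ u v _ fu fv → cong₂ (λ a b → 𝟙 a ∸ 𝟙 b) fu fv

  crossingCount-suc : ∀ {c} n → suc c ≤ p → crossingCount (suc c) (suc n) ≡ crossingCount c n + vertexCount p n
  crossingCount-suc {c} n c<p = begin
    crossingCount (suc c) (suc n)
      ≡⟨ edgeSum-zero-suc {n} (λ u v → 𝟙 (fib (suc c) u) ∸ 𝟙 (fib (suc c) v)) ⟩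
    crossingCount c n + ∑ {n} (λ u → when (fib p u) (𝟙 (fib c u))) + edgeSum {n} p (λ _ _ → 0)
      ≡⟨ cong₂ _+_ (cong (crossingCount c n +_)
                     (∑-cong {n} λ u → when-cong λ fu → cong 𝟙 (fib-antitone u c≤p fu)))
                   (edgeSum-zero {n} p λ _ _ _ _ _ → refl) ⟩
    crossingCount c n + vertexCount p n + 0
      ≡⟨ +-identityʳ _ ⟩
    crossingCount c n + vertexCount p n
      ∎
    where
    open ≡-Reasoning
    c≤p = <⇒≤ c<p

  degreeDeficit-zero : ∀ n → degreeDeficit 0 n ≡ 0
  degreeDeficit-zero n = ∑-zero {n} λ w → trans (cong (when (fib 0 w)) (n∸n≡0 (deg 0 w))) (when-0 (fib 0 w))

  degreeDeficit-suc : ∀ {c} n → suc c ≤ p → degreeDeficit (suc c) (suc n) ≡ degreeDeficit c n + vertexCount p n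
  degreeDeficit-suc {c} n c<p = begin
    degreeDeficit (suc c) (suc n)
      ≡⟨ cong₂ _+_ (∑-cong {n} split) (∑-zero {n} λ _ → refl) ⟩
    ∑ {n} (λ w → when (fib c w) (deg 0 w ∸ deg c w) + 𝟙 (fib p w)) + 0
      ≡⟨ +-identityʳ _ ⟩
    ∑ {n} (λ w → when (fib c w) (deg 0 w ∸ deg c w) + 𝟙 (fib p w))
      ≡⟨ ∑-+ {n} (λ w → when (fib c w) (deg 0 w ∸ deg c w)) (λ w → 𝟙 (fib p w)) ⟩
    degreeDeficit c n + vertexCount p n
      ∎
    where
    open ≡-Reasoning
    split : ∀ (w : Vec Bool n) → when (fib c w) (deg 0 (false ∷ w) ∸ deg (suc c) (false ∷ w))
                                ≡ when (fib c w) (deg 0 w ∸ deg c w) + 𝟙 (fib p w)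
    split w = begin
      when (fib c w) (deg 0 (false ∷ w) ∸ deg (suc c) (false ∷ w))
        ≡⟨ cong (when (fib c w)) (cong₂ _∸_ (deg-zero-false∷ w) (deg-suc-false∷ c w)) ⟩
      when (fib c w) ((deg 0 w + 𝟙 (fib p w)) ∸ deg c w)
        ≡⟨ cong (when (fib c w)) (+-∸-comm (𝟙 (fib p w)) (deg-antitone-state w z≤n)) ⟩
      when (fib c w) ((deg 0 w ∸ deg c w) + 𝟙 (fib p w))
        ≡⟨ when-+-𝟙 (deg 0 w ∸ deg c w) (fib-antitone w (<⇒≤ c<p)) ⟩
      when (fib c w) (deg 0 w ∸ deg c w) + 𝟙 (fib p w)
        ∎

  crossingCount≡window : ∀ n → crossingCount p n ≡ window (vertexCount p) p n
  crossingCount≡window n =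
    window-unique {X = crossingCount} crossingCount-zero (λ _ → refl) crossingCount-suc n ≤-refl

  degreeDeficit≡window : ∀ n → degreeDeficit p n ≡ window (vertexCount p) p n
  degreeDeficit≡window n =
    window-unique {X = degreeDeficit} degreeDeficit-zero (λ _ → refl) degreeDeficit-suc n ≤-refl

  irrSum≡2*window : ∀ n c → irrSum c n ≡ 2 * window (edgeCount c) p n
  irrSum≡2*window zero    c       = sym (cong (2 *_) (window-zeroʳ (edgeCount c) p))
  irrSum≡2*window (suc n) (suc c) = begin
    irrSum (suc c) (suc n)                     ≡⟨ irrSum-suc c n ⟩
    irrSum c n                                 ≡⟨ irrSum≡2*window n c ⟩
    2 * window (edgeCount c) p n               ≡⟨ cong (2 *_) (window-shift refl (edgeCount-suc c) p n) ⟨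
    2 * window (edgeCount (suc c)) p (suc n)   ∎
    where open ≡-Reasoning
  irrSum≡2*window (suc n) zero    = begin
    irrSum 0 (suc n)
      ≡⟨ irrSum-zero-suc n ⟩
    irrSum 0 n + crossingCount p n + degreeDeficit p n + irrSum p n
      ≡⟨ cong₂ _+_ (cong₂ _+_ (cong₂ _+_ (irrSum≡2*window n 0) (crossingCount≡window n))
                              (degreeDeficit≡window n))
                   (irrSum≡2*window n p) ⟩
    2 * W₀ + V + V + 2 * Wₚ
      ≡⟨ regroup W₀ V Wₚ ⟩
    2 * (W₀ + V + Wₚ)
      ≡⟨ cong (2 *_) (trans (window-+ _ (edgeCount p) p n)
                            (cong (_+ Wₚ) (window-+ (edgeCount 0) (vertexCount p) p n))) ⟨
    2 * window (λ k → edgeCount 0 k + vertexCount p k + edgeCount p k) p n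
      ≡⟨ cong (2 *_) (window-shift refl edgeCount-zero-suc p n) ⟨
    2 * window (edgeCount 0) p (suc n)
      ∎
    where
    open ≡-Reasoning
    W₀ = window (edgeCount 0) p n
    V  = window (vertexCount p) p n
    Wₚ = window (edgeCount p) p n
    regroup : ∀ a t b → 2 * a + t + t + 2 * b ≡ 2 * (a + t + b)
    regroup = solve-∀

  irr≡irrSum : ∀ n → irr p n ≡ irrSum 0 n
  irr≡irrSum n = begin
    irr p n
      ≡⟨ sum-map-filterᵇ _ _ (orderedPairs (vertices p n)) ⟩
    sum (map (λ (u , v) → when (adjacent u v) ∣ degree p n u - degree p n v ∣) (orderedPairs (vertices p n)))
      ≡⟨ sum-map-cong (λ (u , v) → ∣∣-split u v) (orderedPairs (vertices p n)) ⟩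
    sum (map (λ (u , v) → down u v + down v u) (orderedPairs (vertices p n)))
      ≡⟨ sum-orderedPairs-vertices down
           (λ u → cong (λ b → when b (degree p n u ∸ degree p n u)) (adjacent-irrefl u)) ⟩
    ∑₂ {n} (λ u v → when (fib 0 u) (when (fib 0 v) (down u v)))
      ≡⟨ ∑₂-fib≡edgeSum 0 down _ (λ u v fu fv →
           trans (cong₂ (λ a b → when (adjacent u v) (a ∸ b)) (degree≡deg u) (degree≡deg v))
                 (when-adjacent≡when-⋖ 0 u v fu fv)) ⟩
    irrSum 0 n
      ∎
    where
    open ≡-Reasoning
    down : Vec Bool n → Vec Bool n → ℕ
    down u v = when (adjacent u v) (degree p n u ∸ degree p n v)
    ∣∣-split : ∀ u v → when (adjacent u v) ∣ degree p n u - degree p n v ∣ ≡ down u v + down v u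
    ∣∣-split u v rewrite adjacent-comm v u with adjacent u v
    ... | true  = ∣m-n∣≡m∸n+n∸m (degree p n u) (degree p n v)
    ... | false = refl

  numEdges≡edgeCount : ∀ n → numEdges p n ≡ edgeCount 0 n
  numEdges≡edgeCount n = begin
    numEdges p n
      ≡⟨ length-filterᵇ _ (orderedPairs (vertices p n)) ⟩
    sum (map (λ (u , v) → 𝟙 (adjacent u v)) (orderedPairs (vertices p n)))
      ≡⟨ sum-map-cong (λ (u , v) → 𝟙-adjacent u v) (orderedPairs (vertices p n)) ⟩
    sum (map (λ (u , v) → 𝟙 (u ⋖ᵇ v) + 𝟙 (v ⋖ᵇ u)) (orderedPairs (vertices p n)))
      ≡⟨ sum-orderedPairs-vertices {n} (λ u v → 𝟙 (u ⋖ᵇ v)) (λ u → cong 𝟙 (⋖ᵇ-irrefl u)) ⟩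
    ∑₂ {n} (λ u v → when (fib 0 u) (when (fib 0 v) (𝟙 (u ⋖ᵇ v))))
      ≡⟨ ∑₂-fib≡edgeSum {n} 0 _ (λ _ _ → 1) (λ _ _ _ _ → refl) ⟩
    edgeCount 0 n
      ∎
    where open ≡-Reasoning

theorem7p2 : (p n : ℕ) → 1 ≤ p → p ≤ n →
    irr p n ≡ 2 * sum (map (λ k → numEdges p (n ∸ suc k)) (upTo p))
theorem7p2 p n _ _ = begin
  irr p n                                                 ≡⟨ irr≡irrSum n ⟩
  irrSum 0 n                                              ≡⟨ irrSum≡2*window n 0 ⟩
  2 * window (edgeCount 0) p n                            ≡⟨ cong (2 *_) (window≡sum-upTo refl p n) ⟩
  2 * sum (map (λ k → edgeCount 0 (n ∸ suc k)) (upTo p))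
    ≡⟨ cong (2 *_) (sum-map-cong (λ k → numEdges≡edgeCount (n ∸ suc k)) (upTo p)) ⟨
  2 * sum (map (λ k → numEdges p (n ∸ suc k)) (upTo p))   ∎
  where
  open ≡-Reasoning
  open FibonacciCube p
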